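{- Let $G=(V,E)$ be a strongly connected digraph in which every directed cycle has at most three edges, with $|V|\ge 4$, and such that no vertex of $G$ is a cut vertex of the underlying undirected graph. Then every redundant edge of $G$ lies on exactly one directed cycle of $G$.
   Context: An edge $e$ of $G$ is redundant if $(V,E\setminus\{e\})$ is still strongly connected; otherwise it is necessary. A cut vertex is a vertex whose removal disconnects the underlying undirected graph. -}

module Defs where

open import Data.Nat using (ℕ; suc; _≤_)
open import Data.Fin using (Fin; _≟_)
open import Data.Bool using (Bool; true; false; _∧_; not)
open import Data.List using (List; []; _∷_; _++_; [_]; length)
open import Data.List.Relation.Unary.Unique.Propositional using (Unique)
open import Data.List.Relation.Unary.Linked using (Linked)
open import Data.List.Membership.Propositional using (_∈_)
open import Data.Product using (_×_; _,_; Σ; ∃)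
open import Data.Sum using (_⊎_)
open import Relation.Nullary using (¬_)
open import Relation.Nullary.Decidable using (⌊_⌋)
open import Relation.Binary.PropositionalEquality using (_≡_; _≢_)
open import Relation.Binary.Construct.Closure.ReflexiveTransitive using (Star)
open import Function.Bundles using (_⇔_)

Digraph : ℕ → Set
Digraph n = Fin n → Fin n → Bool

Edge : ∀ {n} → Digraph n → Fin n → Fin n → Set
Edge G u v = G u v ≡ true

StronglyConnected : ∀ {n} → Digraph n → Set
StronglyConnected {n} G = (u v : Fin n) → Star (Edge G) u v

removeEdge : ∀ {n} → Digraph n → Fin n → Fin n → Digraph n
removeEdge G u v x y = G x y ∧ not (⌊ x ≟ u ⌋ ∧ ⌊ y ≟ v ⌋)

Redundant : ∀ {n} → Digraph n → Fin n → Fin n → Set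
Redundant G u v = Edge G u v × StronglyConnected (removeEdge G u v)

AdjWithout : ∀ {n} → Digraph n → Fin n → Fin n → Fin n → Set
AdjWithout G w x y = x ≢ w × y ≢ w × (Edge G x y ⊎ Edge G y x)

CutVertex : ∀ {n} → Digraph n → Fin n → Set
CutVertex {n} G w =
  ¬ ((x y : Fin n) → x ≢ w → y ≢ w → Star (AdjWithout G w) x y)

pairs : ∀ {A : Set} → List A → List (A × A)
pairs [] = []
pairs (a ∷ []) = []
pairs (a ∷ b ∷ l) = (a , b) ∷ pairs (b ∷ l)

-- A directed cycle: distinct vertices start, rest₁, …, restₖ with edges
-- start → rest₁ → … → restₖ → start.  It has 1 + length rest edges.
record Cycle {n} (G : Digraph n) : Set where
  field
    start  : Fin n
    rest   : List (Fin n)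
    unique : Unique (start ∷ rest)
    linked : Linked (Edge G) (start ∷ rest ++ [ start ])

  closed : List (Fin n)
  closed = start ∷ rest ++ [ start ]

  numEdges : ℕ
  numEdges = suc (length rest)

open Cycle public

OnCycle : ∀ {n} {G : Digraph n} → Cycle G → Fin n → Fin n → Set
OnCycle C x y = (x , y) ∈ pairs (closed C)

-- two cycles are the same cycle (same edge set; ignores choice of start)
SameCycle : ∀ {n} {G : Digraph n} → Cycle G → Cycle G → Set
SameCycle {n} C D = (x y : Fin n) → OnCycle C x y ⇔ OnCycle D x y

OnExactlyOneCycle : ∀ {n} → Digraph n → Fin n → Fin n → Set
OnExactlyOneCycle G u v =
  Σ (Cycle G) λ C → OnCycle C u v × ((D : Cycle G) → OnCycle D u v → SameCycle C D)

-- Strong connectivity gives a cycle through the redundant edge uv, and redundancy a bypass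
-- u → y ⇝ z → v whose inner vertices avoid u and v.  An ear of a vertex set S (a walk outside S,
-- closed into a cycle through vertices of S) has more than three edges as soon as it passes three
-- vertices of S, or two vertices of S and a walk of positive length; so no such ear exists.
-- A cycle through uv is the loop, a digon, or a triangle u → v → w → u.  Triangles with apexes
-- w ≠ x force the bypass through both apexes, and the segment between them is a forbidden ear.
-- A digon and a triangle force the bypass to be u → w → v, making u, v, w a bidirected triangle T.
-- Then each vertex outside T (one exists since n ≥ 4) is entered from and left towards the same
-- vertex of T; this vertex is constant along edges outside T, hence it is a cut vertex.

module Submission where

open import Defs
open import Level using (Level; _⊔_)
open import Data.Nat using (ℕ; suc; _+_; _≤_; _<_; s≤s; z≤n)
open import Data.Nat.Properties using (≤-<-trans; +-comm; +-monoʳ-≤; m+n≮m)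
import Data.Nat.Properties as ℕ
open import Data.Fin using (Fin; _≟_)
open import Data.Fin.Properties using (pigeonhole; ¬∀⟶∃¬)
import Data.Fin.Properties as Fin
open import Data.Bool using (true; false)
open import Data.Maybe using (just)
open import Data.Maybe.Relation.Binary.Connected using (Connected)
open import Data.List using (List; []; _∷_; _++_; [_]; length; last; head; lookup)
open import Data.List.Properties using (++-assoc; ++-identityʳ; length-++)
open import Data.List.Relation.Unary.All using (All; []; _∷_)
import Data.List.Relation.Unary.All as All
open import Data.List.Relation.Unary.All.Properties using (¬Any⇒All¬)
open import Data.List.Relation.Unary.Any using (here; there; index; toSum)
open import Data.List.Relation.Unary.Any.Properties using (lookup-index)
open import Data.List.Relation.Unary.AllPairs using ([]; _∷_)
open import Data.List.Relation.Unary.Unique.Propositional using (Unique)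
open import Data.List.Relation.Unary.Unique.Propositional.Properties using (++⁺)
open import Data.List.Relation.Unary.Linked using (Linked; []; [-]; _∷_)
import Data.List.Relation.Unary.Linked as Linked
import Data.List.Relation.Unary.Linked.Properties as Linked
open import Data.List.Relation.Binary.Disjoint.Propositional using (Disjoint)
open import Data.List.Relation.Binary.Permutation.Propositional using (_↭_; ↭-refl; ↭-sym; ↭-trans)
open import Data.List.Relation.Binary.Permutation.Propositional.Properties using (∈-resp-↭; ++-comm)
open import Data.List.Membership.Propositional using (_∈_; _∉_)
open import Data.List.Membership.Propositional.Properties using (∈-∃++)
import Data.List.Membership.DecPropositional as DecMembership
open import Data.Product using (_×_; _,_; Σ; ∃; proj₁)
open import Data.Sum using (_⊎_; inj₁; inj₂)
import Data.Sum as Sum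
open import Data.Empty using (⊥; ⊥-elim)
open import Function using (id; _∘_)
open import Function.Bundles using (mk⇔)
open import Relation.Nullary using (¬_; yes; no)
open import Relation.Binary using (Rel; DecidableEquality)
open import Relation.Binary.PropositionalEquality using (_≡_; _≢_; refl; sym; trans; cong; subst)
open import Relation.Binary.Construct.Closure.ReflexiveTransitive using (Star; ε; _◅_; _◅◅_)

private
  variable
    a ℓ ℓ′ : Level
    A : Set a

unique-++⁻ʳ : ∀ (xs : List A) {ys} → Unique (xs ++ ys) → Unique ys
unique-++⁻ʳ []       u       = u
unique-++⁻ʳ (_ ∷ xs) (_ ∷ u) = unique-++⁻ʳ xs u

linked-++⁻ʳ : ∀ {R : Rel A ℓ} (xs : List A) {y ys} → Linked R (xs ++ y ∷ ys) → Linked R (y ∷ ys)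
linked-++⁻ʳ []       l = l
linked-++⁻ʳ (_ ∷ xs) l = linked-++⁻ʳ xs (Linked.tail l)

last-++-∷ : ∀ (xs : List A) {y ys} → last (xs ++ y ∷ ys) ≡ last (y ∷ ys)
last-++-∷ []           = refl
last-++-∷ (_ ∷ [])     = refl
last-++-∷ (_ ∷ x ∷ xs) = last-++-∷ (x ∷ xs)

pairs-last : ∀ {x z : A} xs {y} → last (x ∷ xs) ≡ just z → (z , y) ∈ pairs (x ∷ xs ++ [ y ])
pairs-last []       refl = here refl
pairs-last (x ∷ xs) eq   = there (pairs-last xs eq)

∉-∷⁺ : ∀ {x z : A} {xs} → x ≢ z → x ∉ xs → x ∉ z ∷ xs
∉-∷⁺ x≢z x∉xs = Sum.[ x≢z , x∉xs ] ∘ toSum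

∉-pair : ∀ {x u v : A} → x ≢ u → x ≢ v → x ∉ u ∷ v ∷ []
∉-pair x≢u x≢v = ∉-∷⁺ x≢u (∉-∷⁺ x≢v λ ())

record SimplePath {A : Set a} (R : Rel A ℓ) (x y : A) : Set (a ⊔ ℓ) where
  field
    inner    : List A
    distinct : Unique (x ∷ inner)
    steps    : Linked R (x ∷ inner)
    ends     : last (x ∷ inner) ≡ just y
open SimplePath

SimplePath-map : ∀ {R R′ : Rel A ℓ} → (∀ {x y} → R x y → R′ x y) →
                 ∀ {x y} → SimplePath R x y → SimplePath R′ x y
SimplePath-map f p = record
  { inner = inner p ; distinct = distinct p ; steps = Linked.map f (steps p) ; ends = ends p }

SimplePath-nonempty : ∀ {R : Rel A ℓ} {x y} → x ≢ y → (p : SimplePath R x y) → 0 < length (inner p)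
SimplePath-nonempty x≢y record { inner = [] ; ends = refl } = ⊥-elim (x≢y refl)
SimplePath-nonempty x≢y record { inner = _ ∷ _ }            = s≤s z≤n

SimplePath-vertices : ∀ {R : Rel A ℓ} {P : A → Set ℓ′} → (∀ {x y} → R x y → P y) →
                      ∀ {x y} → P x → (p : SimplePath R x y) → All P (x ∷ inner p)
SimplePath-vertices {R = R} {P} target Px p = go Px (steps p)
  where
    go : ∀ {x xs} → P x → Linked R (x ∷ xs) → All P (x ∷ xs)
    go Px [-]      = Px ∷ []
    go Px (r ∷ rs) = Px ∷ go (target r) rs

module _ (_≟ᴬ_ : DecidableEquality A) {R : Rel A ℓ} where
  open DecMembership _≟ᴬ_ using (_∈?_)

  -- Loop erasure: if x already occurs on the path, the loop back to x is cut off.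
  SimplePath-◅ : ∀ {x x′ y} → R x x′ → SimplePath R x′ y → SimplePath R x y
  SimplePath-◅ {x} {x′} r p with x ∈? (x′ ∷ inner p)
  ... | no x∉ = record
    { inner = x′ ∷ inner p ; distinct = ¬Any⇒All¬ _ x∉ ∷ distinct p
    ; steps = r ∷ steps p ; ends = ends p }
  ... | yes x∈ with pre , suf , eq ← ∈-∃++ x∈ = record
    { inner    = suf
    ; distinct = unique-++⁻ʳ pre (subst Unique eq (distinct p))
    ; steps    = linked-++⁻ʳ pre (subst (Linked R) eq (steps p))
    ; ends     = trans (sym (last-++-∷ pre)) (trans (cong last (sym eq)) (ends p)) }

  simplePath : ∀ {x y} → Star R x y → SimplePath R x y
  simplePath ε       = record { inner = [] ; distinct = [] ∷ [] ; steps = [-] ; ends = refl }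
  simplePath (r ◅ s) = SimplePath-◅ r (simplePath s)

module _ {n : ℕ} where
  open DecMembership {A = Fin n} _≟_ using (_∈?_)

  ∃-∉ : (xs : List (Fin n)) → length xs < n → ∃ λ x → x ∉ xs
  ∃-∉ xs len<n = ¬∀⟶∃¬ n (_∈ xs) (_∈? xs) ¬covers
    where
      ¬covers : ¬ (∀ x → x ∈ xs)
      ¬covers covers with i , j , i<j , same ← pigeonhole len<n (index ∘ covers) =
        Fin.<-irrefl (trans (lookup-index (covers i))
                      (trans (cong (lookup xs) same) (sym (lookup-index (covers j))))) i<j

  module _ (G : Digraph n) where

    EdgeAvoiding : List (Fin n) → Fin n → Fin n → Set
    EdgeAvoiding S x y = Edge G x y × x ∉ S × y ∉ S

    spliceCycle : ∀ {y z} (p : SimplePath (Edge G) y z) (r : List (Fin n)) → Unique r →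
                  Disjoint (y ∷ inner p) r → Linked (Edge G) (z ∷ r ++ [ y ]) → Cycle G
    spliceCycle {y} p r r-distinct disjoint closing = record
      { start  = y
      ; rest   = inner p ++ r
      ; unique = ++⁺ (distinct p) r-distinct disjoint
      ; linked = subst (λ l → Linked (Edge G) (y ∷ l)) (sym (++-assoc (inner p) r [ y ]))
                   (Linked.++⁺ (steps p) junction (Linked.tail closing)) }
      where
        junction : Connected (Edge G) (last (y ∷ inner p)) (head (r ++ [ y ]))
        junction = subst (λ m → Connected (Edge G) m (head (r ++ [ y ]))) (sym (ends p))
                     (Linked.head′ closing)

    cycleThrough : StronglyConnected G → ∀ {u v} → Edge G u v → Σ (Cycle G) λ C → OnCycle C u v
    cycleThrough sc {u} {v} uv =
      spliceCycle p [] [] (λ { (_ , ()) }) (uv ∷ [-]) ,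
      pairs-last (inner p ++ []) (subst (λ l → last (v ∷ l) ≡ just u) (sym (++-identityʳ (inner p))) (ends p))
      where
        p : SimplePath (Edge G) v u
        p = simplePath _≟_ (sc v u)

    earCycle : ∀ {S y z} → SimplePath (EdgeAvoiding S) y z → y ∉ S → (r : List (Fin n)) →
               All (_∈ S) r → Unique r → Linked (Edge G) (z ∷ r ++ [ y ]) → Cycle G
    earCycle {S} {y} p y∉S r r⊆S r-distinct =
      spliceCycle (SimplePath-map proj₁ p) r r-distinct
        (λ (x∈p , x∈r) → All.lookup outside x∈p (All.lookup r⊆S x∈r))
      where
        outside : All (_∉ S) (y ∷ inner p)
        outside = SimplePath-vertices (λ (_ , _ , y∉) → y∉) y∉S p

    _HasEdges_ : Cycle G → List (Fin n × Fin n) → Set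
    C HasEdges es = pairs (closed C) ↭ es

    sameCycle : ∀ {es} (C D : Cycle G) → C HasEdges es → D HasEdges es → SameCycle C D
    sameCycle _ _ C≈ D≈ x y =
      mk⇔ (∈-resp-↭ (↭-trans C≈ (↭-sym D≈))) (∈-resp-↭ (↭-trans D≈ (↭-sym C≈)))

    data ShortCycleThrough (u v : Fin n) (C : Cycle G) : Set where
      digon    : Edge G v u → C HasEdges ((u , v) ∷ (v , u) ∷ []) → ShortCycleThrough u v C
      triangle : ∀ {w} → w ≢ u → w ≢ v → Edge G v w → Edge G w u →
                 C HasEdges ((u , v) ∷ (v , w) ∷ (w , u) ∷ []) → ShortCycleThrough u v C

    classify : ∀ {u v} (C : Cycle G) → numEdges C ≤ 3 → u ≢ v → OnCycle C u v →
               ShortCycleThrough u v C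
    classify record { rest = [] } _ u≢v (here refl) = ⊥-elim (u≢v refl)
    classify record { rest = _ ∷ [] ; linked = _ ∷ e₂ ∷ [-] } _ _ (here refl) =
      digon e₂ ↭-refl
    classify record { rest = _ ∷ [] ; linked = e₁ ∷ _ ∷ [-] } _ _ (there (here refl)) =
      digon e₁ (++-comm [ _ ] [ _ ])
    classify record { rest = _ ∷ _ ∷ [] ; unique = (_ ∷ s≢b ∷ []) ∷ (a≢b ∷ []) ∷ _
                    ; linked = _ ∷ e₂ ∷ e₃ ∷ [-] } _ _ (here refl) =
      triangle (s≢b ∘ sym) (a≢b ∘ sym) e₂ e₃ ↭-refl
    classify record { rest = _ ∷ _ ∷ [] ; unique = (s≢a ∷ s≢b ∷ []) ∷ _
                    ; linked = e₁ ∷ _ ∷ e₃ ∷ [-] } _ _ (there (here refl)) =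
      triangle s≢a s≢b e₃ e₁ (++-comm [ _ ] (_ ∷ _ ∷ []))
    classify record { rest = _ ∷ _ ∷ [] ; unique = (s≢a ∷ _) ∷ (a≢b ∷ []) ∷ _
                    ; linked = e₁ ∷ e₂ ∷ _ ∷ [-] } _ _ (there (there (here refl))) =
      triangle a≢b (s≢a ∘ sym) e₁ e₂ (++-comm (_ ∷ _ ∷ []) [ _ ])
    classify record { rest = _ ∷ _ ∷ _ ∷ _ } (s≤s (s≤s (s≤s ()))) _ _

    loopOnly : ∀ {u} (C : Cycle G) → numEdges C ≤ 3 → OnCycle C u u → C HasEdges [ (u , u) ]
    loopOnly record { rest = [] } _ (here refl) = ↭-refl
    loopOnly record { rest = _ ∷ [] ; unique = (s≢a ∷ []) ∷ _ } _ (here refl)         = ⊥-elim (s≢a refl)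
    loopOnly record { rest = _ ∷ [] ; unique = (s≢a ∷ []) ∷ _ } _ (there (here refl)) = ⊥-elim (s≢a refl)
    loopOnly record { rest = _ ∷ _ ∷ [] ; unique = (s≢a ∷ _) ∷ _ } _ (here refl)       = ⊥-elim (s≢a refl)
    loopOnly record { rest = _ ∷ _ ∷ [] ; unique = _ ∷ (a≢b ∷ []) ∷ _ } _ (there (here refl)) =
      ⊥-elim (a≢b refl)
    loopOnly record { rest = _ ∷ _ ∷ [] ; unique = (_ ∷ s≢b ∷ []) ∷ _ } _ (there (there (here refl))) =
      ⊥-elim (s≢b refl)
    loopOnly record { rest = _ ∷ _ ∷ _ ∷ _ } (s≤s (s≤s (s≤s ()))) _

    Entry : List (Fin n) → Fin n → Fin n → Set
    Entry S t y = t ∈ S × ∃ λ y₁ → Edge G t y₁ × y₁ ∉ S × Star (EdgeAvoiding S) y₁ y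

    Exit : List (Fin n) → Fin n → Fin n → Set
    Exit S y t = t ∈ S × ∃ λ yₖ → Star (EdgeAvoiding S) y yₖ × Edge G yₖ t

    lastEntry : ∀ {S x y} → Star (Edge G) x y → y ∉ S →
                (x ∉ S × Star (EdgeAvoiding S) x y) ⊎ ∃ λ t → Entry S t y
    lastEntry ε y∉S = inj₁ (y∉S , ε)
    lastEntry {S} {x} (xx′ ◅ s) y∉S with lastEntry s y∉S
    ... | inj₂ entry = inj₂ entry
    ... | inj₁ (x′∉S , s′) with x ∈? S
    ...   | yes x∈S = inj₂ (x , x∈S , _ , xx′ , x′∉S , s′)
    ...   | no x∉S  = inj₁ (x∉S , (xx′ , x∉S , x′∉S) ◅ s′)

    firstExit : ∀ {S x t} → Star (Edge G) x t → x ∉ S → t ∈ S → ∃ λ t′ → Exit S x t′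
    firstExit ε x∉S t∈S = ⊥-elim (x∉S t∈S)
    firstExit {S} {x} (_◅_ {j = x′} xx′ s) x∉S t∈S with x′ ∈? S
    ... | yes x′∈S = x′ , x′∈S , x , ε , xx′
    ... | no x′∉S with t′ , t′∈S , yₖ , s′ , yₖt′ ← firstExit s x′∉S t∈S =
      t′ , t′∈S , yₖ , (xx′ , x∉S , x′∉S) ◅ s′ , yₖt′

    avoidsOrVisits : ∀ z {S x y} → Star (EdgeAvoiding S) x y → x ∉ S →
                     (x ∉ z ∷ S × Star (EdgeAvoiding (z ∷ S)) x y) ⊎
                     (Star (EdgeAvoiding S) x z × Star (EdgeAvoiding S) z y)
    avoidsOrVisits z {x = x} s x∉S with x ≟ z
    ... | yes refl = inj₂ (ε , s)
    avoidsOrVisits z ε x∉S | no x≢z = inj₁ (∉-∷⁺ x≢z x∉S , ε)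
    avoidsOrVisits z ((xx′ , _ , x′∉S) ◅ s) x∉S | no x≢z with avoidsOrVisits z s x′∉S
    ... | inj₂ (s₁ , s₂) = inj₂ ((xx′ , x∉S , x′∉S) ◅ s₁ , s₂)
    ... | inj₁ (x′∉zS , s′) = inj₁ (∉-∷⁺ x≢z x∉S , (xx′ , ∉-∷⁺ x≢z x∉S , x′∉zS) ◅ s′)

    removeEdge-edge : ∀ {u v x y} → Edge (removeEdge G u v) x y → Edge G x y × (x ≡ u → y ≢ v)
    removeEdge-edge {u} {v} {x} {y} e with G x y | x ≟ u | y ≟ v
    removeEdge-edge () | false | _        | _
    removeEdge-edge () | true  | yes refl | yes refl
    ... | true | yes refl | no y≢v = refl , λ _ → y≢v
    ... | true | no x≢u   | _      = refl , λ x≡u → ⊥-elim (x≢u x≡u)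

    data Bypass (u v : Fin n) : Set where
      bypass : ∀ {y z} → Edge G u y → y ∉ u ∷ v ∷ [] →
               Star (EdgeAvoiding (u ∷ v ∷ [])) y z → Edge G z v → Bypass u v

    removeEdge-bypass : ∀ {u v} → u ≢ v → Star (Edge (removeEdge G u v)) u v → Bypass u v
    removeEdge-bypass {u} {v} u≢v s =
      Sum.[ id , (λ (u∉ , _) → ⊥-elim (u∉ (here refl))) ] (approach u≢v s)
      where
        approach : ∀ {x} → x ≢ v → Star (Edge (removeEdge G u v)) x v →
                   Bypass u v ⊎
                   (x ∉ u ∷ v ∷ [] × ∃ λ z → Star (EdgeAvoiding (u ∷ v ∷ [])) x z × Edge G z v)
        approach x≢v ε = ⊥-elim (x≢v refl)
        approach {x} x≢v (_◅_ {j = x′} e s) with removeEdge-edge e | x ≟ u | x′ ≟ v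
        ... | _  , ¬uv | yes x≡u | yes x′≡v = ⊥-elim (¬uv x≡u x′≡v)
        ... | xx′ , _  | yes refl | no x′≢v with approach x′≢v s
        ...   | inj₁ found                 = inj₁ found
        ...   | inj₂ (x′∉ , z , s′ , zv)   = inj₁ (bypass xx′ x′∉ s′ zv)
        approach {x} x≢v (_ ◅ _) | xx′ , _ | no x≢u | yes refl =
          inj₂ (∉-pair x≢u x≢v , x , ε , xx′)
        approach {x} x≢v (_ ◅ s) | xx′ , _ | no x≢u | no x′≢v with approach x′≢v s
        ...   | inj₁ found               = inj₁ found
        ...   | inj₂ (x′∉ , z , s′ , zv) = inj₂ (x∉ , z , (xx′ , x∉ , x′∉) ◅ s′ , zv)
          where
            x∉ : x ∉ u ∷ v ∷ []
            x∉ = ∉-pair x≢u x≢v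

    module _ (short : (C : Cycle G) → numEdges C ≤ 3) where

      ear-short : ∀ {S y z} (p : SimplePath (EdgeAvoiding S) y z) (y∉S : y ∉ S) (r : List (Fin n)) →
                  All (_∈ S) r → Unique r → Linked (Edge G) (z ∷ r ++ [ y ]) →
                  length r + length (inner p) < 3
      ear-short p y∉S r r⊆S r-distinct closing =
        subst (_< 3) (trans (length-++ (inner p)) (+-comm (length (inner p)) (length r)))
          (short (earCycle p y∉S r r⊆S r-distinct closing))

      ¬ear₃ : ∀ {S y z a b c} → Star (EdgeAvoiding S) y z → y ∉ S →
              a ∈ S → b ∈ S → c ∈ S → a ≢ b → a ≢ c → b ≢ c →
              Edge G z a → Edge G a b → Edge G b c → Edge G c y → ⊥
      ¬ear₃ s y∉S a∈S b∈S c∈S a≢b a≢c b≢c za ab bc cy =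
        m+n≮m 3 _ (ear-short (simplePath _≟_ s) y∉S (_ ∷ _ ∷ _ ∷ []) (a∈S ∷ b∈S ∷ c∈S ∷ [])
                    ((a≢b ∷ a≢c ∷ []) ∷ (b≢c ∷ []) ∷ [] ∷ []) (za ∷ ab ∷ bc ∷ cy ∷ [-]))

      ¬ear₂ : ∀ {S y z a b} → Star (EdgeAvoiding S) y z → y ∉ S → y ≢ z →
              a ∈ S → b ∈ S → a ≢ b → Edge G z a → Edge G a b → Edge G b y → ⊥
      ¬ear₂ {S} {y} {z} s y∉S y≢z a∈S b∈S a≢b za ab by =
        ℕ.<-irrefl refl (≤-<-trans (+-monoʳ-≤ 2 (SimplePath-nonempty y≢z p))
          (ear-short p y∉S (_ ∷ _ ∷ []) (a∈S ∷ b∈S ∷ []) ((a≢b ∷ []) ∷ [] ∷ []) (za ∷ ab ∷ by ∷ [-])))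
        where
          p : SimplePath (EdgeAvoiding S) y z
          p = simplePath _≟_ s

      module _ {u v : Fin n} (u≢v : u ≢ v) where

        private
          ¬bypass-avoiding : ∀ {w y z} → w ≢ u → w ≢ v → Edge G v w → Edge G w u →
                          Edge G u y → y ∉ w ∷ u ∷ v ∷ [] →
                          Star (EdgeAvoiding (w ∷ u ∷ v ∷ [])) y z → Edge G z v → ⊥
          ¬bypass-avoiding w≢u w≢v vw wu uy y∉ s zv =
            ¬ear₃ s y∉ (there (there (here refl))) (here refl) (there (here refl))
              (w≢v ∘ sym) (u≢v ∘ sym) w≢u zv vw wu uy

          ¬apex-path : ∀ {w x} → w ≢ x → w ≢ u → w ≢ v → Star (EdgeAvoiding (u ∷ v ∷ [])) w x →
                    Edge G x u → Edge G u v → Edge G v w → ⊥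
          ¬apex-path w≢x w≢u w≢v s xu uv vw =
            ¬ear₂ s (∉-pair w≢u w≢v) w≢x (here refl) (there (here refl)) u≢v xu uv vw

        digon-triangle-bidirected : ∀ {w} → Bypass u v → Edge G v u →
                                    w ≢ u → w ≢ v → Edge G v w → Edge G w u →
                                    Edge G u w × Edge G w v
        digon-triangle-bidirected {w} (bypass {y} {z} uy y∉ s zv) vu w≢u w≢v vw wu with y ≟ z
        ... | no y≢z = ⊥-elim (¬ear₂ s y∉ y≢z (there (here refl)) (here refl) (u≢v ∘ sym) zv vu uy)
        ... | yes refl with y ≟ w
        ...   | yes refl = uy , zv
        ...   | no y≢w   = ⊥-elim (¬bypass-avoiding w≢u w≢v vw wu uy (∉-∷⁺ y≢w y∉) ε zv)

        triangle-apex-unique : ∀ {w x} → Bypass u v → Edge G u v →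
                               w ≢ u → w ≢ v → Edge G v w → Edge G w u →
                               x ≢ u → x ≢ v → Edge G v x → Edge G x u → w ≡ x
        triangle-apex-unique {w} {x} (bypass uy y∉ s zv) uv w≢u w≢v vw wu x≢u x≢v vx xu with w ≟ x
        ... | yes w≡x = w≡x
        ... | no w≢x with avoidsOrVisits w s y∉
        ...   | inj₁ (y∉′ , s′) = ⊥-elim (¬bypass-avoiding w≢u w≢v vw wu uy y∉′ s′ zv)
        ...   | inj₂ (s₁ , s₂) with avoidsOrVisits x s₁ y∉
        ...     | inj₂ (_ , x⇝w) = ⊥-elim (¬apex-path (w≢x ∘ sym) x≢u x≢v x⇝w wu uv vx)
        ...     | inj₁ (y∉′ , s₁′) with avoidsOrVisits x s₂ (∉-pair w≢u w≢v)
        ...       | inj₂ (w⇝x , _) = ⊥-elim (¬apex-path w≢x w≢u w≢v w⇝x xu uv vw)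
        ...       | inj₁ (_ , s₂′) = ⊥-elim (¬bypass-avoiding x≢u x≢v vx xu uy y∉′ (s₁′ ◅◅ s₂′) zv)

      module _ (sc : StronglyConnected G) {u v w : Fin n} (u≢v : u ≢ v) (u≢w : u ≢ w) (v≢w : v ≢ w)
               (uv : Edge G u v) (vu : Edge G v u) (vw : Edge G v w) (wv : Edge G w v)
               (uw : Edge G u w) (wu : Edge G w u) where

        private
          T : List (Fin n)
          T = u ∷ v ∷ w ∷ []

          detour : ∀ {a b} → a ∈ T → b ∈ T → a ≢ b →
                   ∃ λ c → c ∈ T × b ≢ c × c ≢ a × Edge G b c × Edge G c a
          detour (here refl)                (here refl)                a≢b = ⊥-elim (a≢b refl)
          detour (here refl)                (there (here refl))        _ =
            w , there (there (here refl)) , v≢w , u≢w ∘ sym , vw , wu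
          detour (here refl)                (there (there (here refl))) _ =
            v , there (here refl) , v≢w ∘ sym , u≢v ∘ sym , wv , vu
          detour (there (here refl))        (here refl)                _ =
            w , there (there (here refl)) , u≢w , v≢w ∘ sym , uw , wv
          detour (there (here refl))        (there (here refl))        a≢b = ⊥-elim (a≢b refl)
          detour (there (here refl))        (there (there (here refl))) _ =
            u , here refl , u≢w ∘ sym , u≢v , wu , uv
          detour (there (there (here refl))) (here refl)               _ =
            v , there (here refl) , u≢v , v≢w , uv , vw
          detour (there (there (here refl))) (there (here refl))       _ =
            u , here refl , u≢v ∘ sym , u≢w , vu , uw
          detour (there (there (here refl))) (there (there (here refl))) a≢b = ⊥-elim (a≢b refl)

          entry-exit : ∀ {a b y} → Entry T a y → Exit T y b → a ≡ b
          entry-exit {a} {b} (a∈T , y₁ , ay₁ , y₁∉T , s₁) (b∈T , yₖ , s₂ , yₖb) with a ≟ b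
          ... | yes a≡b = a≡b
          ... | no a≢b with c , c∈T , b≢c , c≢a , bc , ca ← detour a∈T b∈T a≢b =
            ⊥-elim (¬ear₃ (s₁ ◅◅ s₂) y₁∉T b∈T c∈T a∈T b≢c (a≢b ∘ sym) c≢a yₖb bc ca ay₁)

          entry : ∀ {y} → y ∉ T → ∃ λ a → Entry T a y
          entry {y} y∉T with lastEntry (sc u y) y∉T
          ... | inj₁ (u∉T , _) = ⊥-elim (u∉T (here refl))
          ... | inj₂ found     = found

          exit : ∀ {y} → y ∉ T → ∃ λ b → Exit T y b
          exit {y} y∉T = firstExit (sc y u) y∉T (here refl)

          entry-unique : ∀ {a a′ y} → y ∉ T → Entry T a y → Entry T a′ y → a ≡ a′
          entry-unique y∉T ea ea′ with _ , eb ← exit y∉T = trans (entry-exit ea eb) (sym (entry-exit ea′ eb))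

          entry-adjacent : ∀ {a y z} → y ∉ T → z ∉ T → Edge G y z ⊎ Edge G z y → Entry T a y → Entry T a z
          entry-adjacent y∉T z∉T (inj₁ yz) (a∈T , y₁ , ay₁ , y₁∉T , s) =
            a∈T , y₁ , ay₁ , y₁∉T , s ◅◅ ((yz , y∉T , z∉T) ◅ ε)
          entry-adjacent {a} {z = z} y∉T z∉T (inj₂ zy) ea
            with b , (b∈T , yₖ , s , yₖb) ← exit y∉T | a′ , ea′ ← entry z∉T =
            subst (λ t → Entry T t z) (trans a′≡b (sym a≡b)) ea′
            where
              a≡b : a ≡ b
              a≡b = entry-exit ea (b∈T , yₖ , s , yₖb)
              a′≡b : a′ ≡ b
              a′≡b = entry-exit ea′ (b∈T , yₖ , (zy , z∉T , y∉T) ◅ s , yₖb)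

          separated : ∀ {a y t} → y ∉ T → Entry T a y → t ∈ T → ¬ Star (AdjWithout G a) y t
          separated y∉T _ t∈T ε = y∉T t∈T
          separated {a} {y} y∉T ea t∈T (_◅_ {j = y′} (_ , y′≢a , adj) s) with y′ ∈? T
          ... | no y′∉T  = separated y′∉T (entry-adjacent y∉T y′∉T adj ea) t∈T s
          ... | yes y′∈T = y′≢a (sym (attached adj))
            where
              attached : Edge G y y′ ⊎ Edge G y′ y → a ≡ y′
              attached (inj₁ yy′) = entry-exit ea (y′∈T , y , ε , yy′)
              attached (inj₂ y′y) = entry-unique y∉T ea (y′∈T , y , y′y , y∉T , ε)

          otherThan : ∀ a → ∃ λ t → t ∈ T × t ≢ a
          otherThan a with a ≟ u
          ... | yes refl = v , there (here refl) , u≢v ∘ sym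
          ... | no a≢u   = u , here refl , a≢u ∘ sym

        bidirectedTriangle-cutVertex : 3 < n → ∃ λ a → CutVertex G a
        bidirectedTriangle-cutVertex 3<n
          with x , x∉T ← ∃-∉ T 3<n
          with a , ea ← entry x∉T
          with t , t∈T , t≢a ← otherThan a
          = a , λ connected → separated x∉T ea t∈T (connected x t (λ { refl → x∉T (proj₁ ea) }) t≢a)

      module _ (sc : StronglyConnected G) (3<n : 3 < n) (noCut : ∀ w → ¬ CutVertex G w) where

        ¬digon∧triangle : ∀ {u v w} → u ≢ v → Edge G u v → Bypass u v → Edge G v u →
                          w ≢ u → w ≢ v → Edge G v w → Edge G w u → ⊥
        ¬digon∧triangle u≢v uv b vu w≢u w≢v vw wu
          with uw , wv ← digon-triangle-bidirected u≢v b vu w≢u w≢v vw wu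
          with a , cut ← bidirectedTriangle-cutVertex sc u≢v (w≢u ∘ sym) (w≢v ∘ sym) uv vu vw wv uw wu 3<n
          = noCut a cut

        bypassed-cycles-agree : ∀ {u v} → u ≢ v → Edge G u v → Bypass u v →
                                (C D : Cycle G) → OnCycle C u v → OnCycle D u v → SameCycle C D
        bypassed-cycles-agree u≢v uv b C D C∋uv D∋uv
          with classify C (short C) u≢v C∋uv | classify D (short D) u≢v D∋uv
        ... | digon _ C≈ | digon _ D≈ = sameCycle C D C≈ D≈
        ... | digon vu _ | triangle w≢u w≢v vw wu _ = ⊥-elim (¬digon∧triangle u≢v uv b vu w≢u w≢v vw wu)
        ... | triangle w≢u w≢v vw wu _ | digon vu _ = ⊥-elim (¬digon∧triangle u≢v uv b vu w≢u w≢v vw wu)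
        ... | triangle w≢u w≢v vw wu C≈ | triangle x≢u x≢v vx xu D≈
          with refl ← triangle-apex-unique u≢v b uv w≢u w≢v vw wu x≢u x≢v vx xu = sameCycle C D C≈ D≈

        redundant-cycles-agree : ∀ {u v} → Redundant G u v →
                                 (C D : Cycle G) → OnCycle C u v → OnCycle D u v → SameCycle C D
        redundant-cycles-agree {u} {v} (uv , sc∖uv) C D C∋uv D∋uv with u ≟ v
        ... | yes refl = sameCycle C D (loopOnly C (short C) C∋uv) (loopOnly D (short D) D∋uv)
        ... | no u≢v   = bypassed-cycles-agree u≢v uv (removeEdge-bypass u≢v (sc∖uv u v)) C D C∋uv D∋uv

lemma1 : (n : ℕ) → (G : Digraph n) → StronglyConnected G →
    ((C : Cycle G) → numEdges C ≤ 3) → 4 ≤ n →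
    ((w : Fin n) → ¬ CutVertex G w) →
    (u v : Fin n) → Redundant G u v → OnExactlyOneCycle G u v
lemma1 n G sc short 3<n noCut u v redundant
  with C , C∋uv ← cycleThrough G sc (proj₁ redundant)
  = C , C∋uv , λ D D∋uv → redundant-cycles-agree G short sc 3<n noCut redundant C D C∋uv D∋uv
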